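{- Let $G=(Q,\Sigma_r,T)$ be an $m$-graph, let $t=(q,a,q')\in T$ and let $\theta'$ be a simple fry-pan starting from $q'$ such that the fry-pan $t\theta'$ is not simple. Then there exists a minimal non-empty prefix $\pi$ of $t\theta'$ terminating in $q$. Moreover, the fry-pan $\theta$ such that $t\theta'=\pi\theta$ and the fry-pan $\pi^\omega$ are simple, and $\Lambda_{r,m,a}(\lambda_{r,m}(\theta'))\in\mathrm{conv}(\{\lambda_{r,m}(\theta),\lambda_{r,m}(\pi^\omega)\})$.
   Context: Integers $r\ge2$, $m\ge1$, $\Sigma_r=\{0,\ldots,r-1\}$. For an infinite word $w$ over $\Sigma_r$, $\lambda_{r,m}(w)[i]=-\sum_{j\ge0}w(mj+i)/r^{j+1}$; for an infinite path, $\lambda_{r,m}$ is applied to its label. $\Lambda_{r,m,a}(x)=(\frac{x[m]-a}{r},x[1],\ldots,x[m-1])$ for $a\in\Sigma_r$. A graph labelled by $\Sigma_r$ is $G=(Q,\Sigma_r,T)$, $T\subseteq Q\times\Sigma_r\times Q$, $Q$ finite nonempty. Finite paths are sequences of transitions $(q_0,a_1,q_1),\ldots,(q_{k-1},a_k,q_k)$, $k\ge0$, terminating in $q_k$; a cycle is such a path with $k\ge1$ and $q_0=q_k$; $G$ is an $m$-graph if $m$ divides the length of every cycle. For a cycle $\pi$, $\pi^\omega$ is the infinite path repeating $\pi$. A fry-pan is an infinite path of the form $t_1\cdots t_i(t_{i+1}\cdots t_k)^\omega$ with $0\le i<k$, $t_j=(q_{j-1},a_j,q_j)$ and $q_k=q_i$;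 it starts from $q_0$ and is simple if $q_0,\ldots,q_{k-1}$ are pairwise distinct. -}

module Defs where

open import Data.Nat as ℕ using (ℕ; zero; suc; _^_; _<_)
open import Data.Nat.DivMod using (_mod_)
open import Data.Nat.Divisibility using () renaming (_∣_ to _divides_)
open import Data.Integer as ℤ using (ℤ; +_)
open import Data.Rational using (ℚ; _/_; _+_; _*_; _-_; -_; ∣_∣; _≤_; 0ℚ; 1ℚ)
open import Data.Fin using (Fin; toℕ; fromℕ; inject₁) renaming (zero to fz; suc to fs)
open import Data.List using (List; []; _∷_; _++_; map; length; lookup)
open import Data.List.Relation.Unary.Unique.Propositional using (Unique)
open import Data.Product using (Σ; _×_; ∃-syntax)
open import Data.Unit using (⊤)
open import Relation.Binary.PropositionalEquality using (_≡_)

-- frac z d = z / d  (only used with d ≥ 1; value for d = 0 is irrelevant)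
frac : ℤ → ℕ → ℚ
frac z zero    = 0ℚ
frac z (suc d) = z / suc d

ℕ→ℚ : ℕ → ℚ
ℕ→ℚ k = (+ k) / 1

-- Graphs labelled by Σ_r = Fin r, with state set Q = Fin n,
-- transition relation T ⊆ Q × Σ_r × Q given as a predicate.

module _ {n r : ℕ} (T : Fin n → Fin r → Fin n → Set) where

  record Trans : Set where
    constructor tr
    field
      src   : Fin n
      lab   : Fin r
      tgt   : Fin n
      valid : T src lab tgt
  open Trans public

  Consec : List Trans → Set
  Consec []             = ⊤
  Consec (t ∷ [])       = ⊤
  Consec (t ∷ t' ∷ ts)  = tgt t ≡ src t' × Consec (t' ∷ ts)

  lastTgt : Trans → List Trans → Fin n
  lastTgt t []        = tgt t
  lastTgt t (t' ∷ ts) = lastTgt t' ts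

  IsCycle : Trans → List Trans → Set
  IsCycle t ts = Consec (t ∷ ts) × src t ≡ lastTgt t ts

  IsMGraph : ℕ → Set
  IsMGraph m = ∀ (t : Trans) (ts : List Trans) → IsCycle t ts →
               m divides length (t ∷ ts)

  -- A fry-pan t_1 ⋯ t_i (t_{i+1} ⋯ t_k)^ω : stem = t_1⋯t_i, loop = c ∷ cs = t_{i+1}⋯t_k
  record FryPan : Set where
    field
      stem   : List Trans
      c      : Trans
      cs     : List Trans
      consec : Consec (stem ++ c ∷ cs)
      closed : lastTgt c cs ≡ src c
  open FryPan public

  -- infinite paths: the j-th transition (j = 0,1,2,…)
  InfPath : Set
  InfPath = ℕ → Trans

  cyc : Trans → List Trans → InfPath
  cyc c cs j = lookup (c ∷ cs) (j mod suc (length cs))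

  evPer : List Trans → Trans → List Trans → InfPath
  evPer []       c cs j       = cyc c cs j
  evPer (x ∷ xs) c cs zero    = x
  evPer (x ∷ xs) c cs (suc j) = evPer xs c cs j

  path : FryPan → InfPath
  path F = evPer (stem F) (c F) (cs F)

  start : FryPan → Fin n
  start F = src (path F 0)

  SimpleRep : FryPan → Set
  SimpleRep F = Unique (map src (stem F ++ c F ∷ cs F))

  IsSimpleFryPan : InfPath → Set
  IsSimpleFryPan p = Σ FryPan λ F → SimpleRep F × (∀ j → path F j ≡ p j)

  consPath : Trans → InfPath → InfPath
  consPath t p zero    = t
  consPath t p (suc j) = p j

  -- π^ω where π is the prefix p 0 ⋯ p k0 (length suc k0)
  periodicPrefix : ℕ → InfPath → InfPath
  periodicPrefix k0 p j = p (toℕ (j mod suc k0))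

  dropPath : ℕ → InfPath → InfPath
  dropPath k p j = p (k ℕ.+ j)

  -- the label of an infinite path, as a word indexed from 1:
  -- word p (suc k) = label of the (k+1)-th transition = p k
  word : InfPath → ℕ → Fin r
  word p zero    = lab (p 0)     -- unused (words are indexed from 1)
  word p (suc k) = lab (p k)

-- For a word w (indexed from 1) and i ∈ {1,…,m} (encoded as
-- Fin m, index i' ↦ i = i'+1), partial sums
--   S_N[i] = Σ_{j<N} w(mj+i)/r^{j+1}
-- and λ_{r,m}(w)[i] = - lim S_N[i].  Since 0 ≤ w(·) ≤ r-1, the tail after N
-- terms is in [0, 1/r^N]; the limit is the unique real x with
-- |x + S_N| ≤ 1/r^N for all N.

partialSum : (r m : ℕ) → (ℕ → Fin r) → Fin m → ℕ → ℚ
partialSum r m w i zero    = 0ℚ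
partialSum r m w i (suc N) =
  partialSum r m w i N + ℕ→ℚ (toℕ (w (m ℕ.* N ℕ.+ suc (toℕ i)))) * frac (+ 1) (r ^ suc N)

IsLambda : (r m : ℕ) → (ℕ → Fin r) → (Fin m → ℚ) → Set
IsLambda r m w x = ∀ (i : Fin m) (N : ℕ) → ∣ x i + partialSum r m w i N ∣ ≤ frac (+ 1) (r ^ N)

Λ : (r m : ℕ) → Fin r → (Fin m → ℚ) → Fin m → ℚ
Λ r (suc m') a x fz     = (x (fromℕ m') - ℕ→ℚ (toℕ a)) * frac (+ 1) r
Λ r (suc m') a x (fs i) = x (inject₁ i)

InConv2 : {m : ℕ} → (Fin m → ℚ) → (Fin m → ℚ) → (Fin m → ℚ) → Set
InConv2 p y z = ∃[ c ] (0ℚ ≤ c × c ≤ 1ℚ × (∀ i → p i ≡ c * y i + (1ℚ - c) * z i))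

module Submission where

-- If no source of θ' among its first s + 1 + L positions were q, t θ'
-- would be simple; the least such position k0 ends the cycle π, and the shapes of
-- θ (θ' shifted by k0) and of π^ω follow from that of θ' and the minimality of k0.
--
-- We
-- compute λ of a word with a prepended letter (a Λ-step), of the suffix after m·l
-- letters, and of an m·l-periodic word (a geometric series).  For a prefix of
-- length m·l they give λ(w) = r^-l λ(suffix) + (1 - r^-l) λ(prefix^ω).  Since G
-- is an m-graph, the cycle π has length m·l, and the proposition follows.

open import Data.Nat using (ℕ; suc)
open import Data.Fin using (Fin)

module RationalFacts where

  open import Defs
  open import Data.Nat as ℕ using (ℕ; zero; suc)
  open import Data.Integer as ℤ using (+_)
  import Data.Integer.Properties as ℤ
  import Data.Nat.Properties as ℕ
  open import Data.Rational
  open import Data.Rational.Properties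
  import Data.Rational.Unnormalised as U
  import Data.Rational.Unnormalised.Properties as U
  open import Data.Rational.Solver using (module +-*-Solver)
  open import Data.Product using (_×_; _,_)
  open import Data.Sum using (inj₁; inj₂)
  open import Relation.Binary.PropositionalEquality

  open +-*-Solver

  -- The cast ℕ→ℚ k = (+ k) / 1 and the fractions frac (+ 1) d = 1 / d go through
  -- normalisation; their algebra is transported from the unnormalised rationals,
  -- where it holds by computation, along fromℚᵘ.

  fromℚᵘ-homo-+ : ∀ p q → fromℚᵘ (p U.+ q) ≡ fromℚᵘ p + fromℚᵘ q
  fromℚᵘ-homo-+ p q = toℚᵘ-injective (U.≃-trans (toℚᵘ-fromℚᵘ (p U.+ q))
    (U.≃-sym (U.≃-trans (toℚᵘ-homo-+ (fromℚᵘ p) (fromℚᵘ q))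
      (U.+-cong (toℚᵘ-fromℚᵘ p) (toℚᵘ-fromℚᵘ q)))))

  fromℚᵘ-homo-* : ∀ p q → fromℚᵘ (p U.* q) ≡ fromℚᵘ p * fromℚᵘ q
  fromℚᵘ-homo-* p q = toℚᵘ-injective (U.≃-trans (toℚᵘ-fromℚᵘ (p U.* q))
    (U.≃-sym (U.≃-trans (toℚᵘ-homo-* (fromℚᵘ p) (fromℚᵘ q))
      (U.*-cong (toℚᵘ-fromℚᵘ p) (toℚᵘ-fromℚᵘ q)))))

  fromℚᵘ-mono-≤ : ∀ {p q} → p U.≤ q → fromℚᵘ p ≤ fromℚᵘ q
  fromℚᵘ-mono-≤ {p} {q} p≤q = toℚᵘ-cancel-≤
    (U.≤-respʳ-≃ (U.≃-sym (toℚᵘ-fromℚᵘ q)) (U.≤-respˡ-≃ (U.≃-sym (toℚᵘ-fromℚᵘ p)) p≤q))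

  ℕ→ℚᵘ : ℕ → U.ℚᵘ
  ℕ→ℚᵘ k = U.mkℚᵘ (+ k) 0

  ℕ→ℚ-homo-+ : ∀ a b → ℕ→ℚ (a ℕ.+ b) ≡ ℕ→ℚ a + ℕ→ℚ b
  ℕ→ℚ-homo-+ a b = trans (fromℚᵘ-cong {ℕ→ℚᵘ (a ℕ.+ b)} {ℕ→ℚᵘ a U.+ ℕ→ℚᵘ b} (U.*≡* eq)) (fromℚᵘ-homo-+ (ℕ→ℚᵘ a) (ℕ→ℚᵘ b))
    where
    eq : + (a ℕ.+ b) ℤ.* + 1 ≡ (+ a ℤ.* + 1 ℤ.+ + b ℤ.* + 1) ℤ.* + 1
    eq = begin
      + (a ℕ.+ b) ℤ.* + 1             ≡⟨ ℤ.*-identityʳ _ ⟩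
      + a ℤ.+ + b                     ≡⟨ cong₂ ℤ._+_ (ℤ.*-identityʳ (+ a)) (ℤ.*-identityʳ (+ b)) ⟨
      + a ℤ.* + 1 ℤ.+ + b ℤ.* + 1     ≡⟨ ℤ.*-identityʳ _ ⟨
      (+ a ℤ.* + 1 ℤ.+ + b ℤ.* + 1) ℤ.* + 1 ∎
      where open ≡-Reasoning

  ℕ→ℚ-mono-≤ : ∀ {a b} → a ℕ.≤ b → ℕ→ℚ a ≤ ℕ→ℚ b
  ℕ→ℚ-mono-≤ {a} {b} a≤b = fromℚᵘ-mono-≤ {ℕ→ℚᵘ a} {ℕ→ℚᵘ b}
    (U.*≤* (subst₂ ℤ._≤_ (sym (ℤ.*-identityʳ (+ a))) (sym (ℤ.*-identityʳ (+ b))) (ℤ.+≤+ a≤b)))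

  ℕ→ℚ-nonNeg : ∀ a → 0ℚ ≤ ℕ→ℚ a
  ℕ→ℚ-nonNeg a = ℕ→ℚ-mono-≤ {0} {a} ℕ.z≤n

  ℕ→ℚ*frac≡1 : ∀ d → ℕ→ℚ (suc d) * frac (+ 1) (suc d) ≡ 1ℚ
  ℕ→ℚ*frac≡1 d = trans (sym (fromℚᵘ-homo-* (ℕ→ℚᵘ (suc d)) (U.mkℚᵘ (+ 1) d)))
    (fromℚᵘ-cong {ℕ→ℚᵘ (suc d) U.* U.mkℚᵘ (+ 1) d} {ℕ→ℚᵘ 1} (U.*≡* (cong ℤ.+[1+_] eq)))
    where
    eq : d ℕ.* 1 ℕ.* 1 ≡ d ℕ.+ 0 ℕ.+ 0
    eq = trans (ℕ.*-identityʳ (d ℕ.* 1)) (trans (ℕ.*-identityʳ d)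
           (sym (trans (ℕ.+-identityʳ _) (ℕ.+-identityʳ d))))

  frac-homo-* : ∀ a b → frac (+ 1) (suc a ℕ.* suc b) ≡ frac (+ 1) (suc a) * frac (+ 1) (suc b)
  frac-homo-* a b = fromℚᵘ-homo-* (U.mkℚᵘ (+ 1) a) (U.mkℚᵘ (+ 1) b)

  frac-nonNeg : ∀ d → 0ℚ ≤ frac (+ 1) d
  frac-nonNeg zero    = ≤-refl
  frac-nonNeg (suc d) = nonNegative⁻¹ (frac (+ 1) (suc d)) {{normalize-nonNeg 1 (suc d)}}

  frac-pos : ∀ d → 0ℚ < frac (+ 1) (suc d)
  frac-pos d = positive⁻¹ (frac (+ 1) (suc d)) {{normalize-pos 1 (suc d)}}

  -- Order facts in the form used below: inequalities are compared through
  -- nonnegative differences, so that the ring solver can rearrange them.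

  0≤q-p⇒p≤q : ∀ {p q} → 0ℚ ≤ q - p → p ≤ q
  0≤q-p⇒p≤q {p} {q} 0≤q-p =
    subst₂ _≤_ (+-identityʳ p) (solve 2 (λ p q → p :+ (q :- p) := q) refl p q) (+-monoʳ-≤ p 0≤q-p)

  p≤q⇒0≤q-p : ∀ {p q} → p ≤ q → 0ℚ ≤ q - p
  p≤q⇒0≤q-p {p} {q} p≤q = subst (_≤ q - p) (+-inverseʳ p) (+-monoˡ-≤ (- p) p≤q)

  *-monoʳ-nonNeg : ∀ {p q c} → 0ℚ ≤ c → p ≤ q → p * c ≤ q * c
  *-monoʳ-nonNeg {c = c} 0≤c = *-monoʳ-≤-nonNeg c {{nonNegative 0≤c}}

  *-monoˡ-nonNeg : ∀ {p q c} → 0ℚ ≤ c → p ≤ q → c * p ≤ c * q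
  *-monoˡ-nonNeg {c = c} 0≤c = *-monoˡ-≤-nonNeg c {{nonNegative 0≤c}}

  nonNeg-* : ∀ {p q} → 0ℚ ≤ p → 0ℚ ≤ q → 0ℚ ≤ p * q
  nonNeg-* {p} {q} 0≤p 0≤q = subst (_≤ p * q) (*-zeroˡ q) (*-monoʳ-nonNeg 0≤q 0≤p)

  neg-involutive : ∀ p → - (- p) ≡ p
  neg-involutive p = solve 1 (λ p → :- (:- p) := p) refl p

  ∣∣≤-intro : ∀ {x b} → - b ≤ x → x ≤ b → ∣ x ∣ ≤ b
  ∣∣≤-intro {x} {b} -b≤x x≤b with ∣p∣≡p∨∣p∣≡-p x
  ... | inj₁ ∣x∣≡x  = subst (_≤ b) (sym ∣x∣≡x) x≤b
  ... | inj₂ ∣x∣≡-x = subst₂ _≤_ (sym ∣x∣≡-x) (neg-involutive b) (neg-antimono-≤ -b≤x)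

  p≤∣p∣ : ∀ p → p ≤ ∣ p ∣
  p≤∣p∣ p with ∣p∣≡p∨∣p∣≡-p p
  ... | inj₁ ∣p∣≡p  = ≤-reflexive (sym ∣p∣≡p)
  ... | inj₂ ∣p∣≡-p = ≤-trans (subst (_≤ 0ℚ) (neg-involutive p) (neg-antimono-≤ (subst (0ℚ ≤_) ∣p∣≡-p (0≤∣p∣ p))))
                               (0≤∣p∣ p)

  ∣∣≤-elim : ∀ {x b} → ∣ x ∣ ≤ b → - b ≤ x × x ≤ b
  ∣∣≤-elim {x} {b} ∣x∣≤b =
    subst (- b ≤_) (neg-involutive x) (neg-antimono-≤ (≤-trans (p≤∣p∣ (- x)) (subst (_≤ b) (sym (∣-p∣≡∣p∣ x)) ∣x∣≤b))) ,
    ≤-trans (p≤∣p∣ x) ∣x∣≤b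

  ∣∣≤-scale : ∀ {c x b} → 0ℚ ≤ c → ∣ x ∣ ≤ b → ∣ c * x ∣ ≤ c * b
  ∣∣≤-scale {c} {x} 0≤c ∣x∣≤b =
    subst (_≤ _) (sym (trans (∣p*q∣≡∣p∣*∣q∣ c x) (cong (_* ∣ x ∣) (0≤p⇒∣p∣≡p 0≤c)))) (*-monoˡ-nonNeg 0≤c ∣x∣≤b)

module Powers (r' : ℕ) where

  open import Defs
  open import Data.Nat as ℕ using (ℕ; zero; suc)
  open import Data.Integer using (+_)
  open import Data.Fin using (Fin; toℕ) renaming (zero to fz; suc to fs)
  import Data.Fin.Properties as Fin
  open import Data.Rational
  open import Data.Rational.Properties
  open import Data.Rational.Solver using (module +-*-Solver)
  open import Data.Product using (∃; _×_; _,_; proj₁; proj₂)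
  open import Relation.Binary.PropositionalEquality
  open RationalFacts
  open +-*-Solver

  r : ℕ
  r = suc (suc r')

  u : ℚ
  u = frac (+ 1) r

  e : ℕ → ℚ
  e N = frac (+ 1) (r ℕ.^ N)

  -- r^N is a successor, so that frac computes on it
  r^N-suc : ∀ N → ∃ λ k → r ℕ.^ N ≡ suc k
  r^N-suc zero = 0 , refl
  r^N-suc (suc N) with r^N-suc N
  ... | k , r^N≡1+k rewrite r^N≡1+k = _ , refl

  e-suc : ∀ N → e (suc N) ≡ u * e N
  e-suc N with r ℕ.^ N | r^N-suc N
  ... | .(suc k) | k , refl = frac-homo-* (suc r') k

  e-homo-+ : ∀ a b → e (a ℕ.+ b) ≡ e a * e b
  e-homo-+ zero b = sym (*-identityˡ (e b))
  e-homo-+ (suc a) b = begin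
    e (suc a ℕ.+ b)        ≡⟨ e-suc (a ℕ.+ b) ⟩
    u * e (a ℕ.+ b)        ≡⟨ cong (u *_) (e-homo-+ a b) ⟩
    u * (e a * e b)        ≡⟨ *-assoc u (e a) (e b) ⟨
    u * e a * e b          ≡⟨ cong (_* e b) (e-suc a) ⟨
    e (suc a) * e b        ∎
    where open ≡-Reasoning

  e-one : e 1 ≡ u
  e-one = trans (e-suc 0) (*-identityʳ u)

  r*u≡1 : ℕ→ℚ r * u ≡ 1ℚ
  r*u≡1 = ℕ→ℚ*frac≡1 (suc r')

  pow : ℕ → ℚ
  pow N = ℕ→ℚ (r ℕ.^ N)

  e*pow≡1 : ∀ N → e N * pow N ≡ 1ℚ
  e*pow≡1 N with r ℕ.^ N | r^N-suc N
  ... | .(suc k) | k , refl = trans (*-comm (frac (+ 1) (suc k)) (ℕ→ℚ (suc k))) (ℕ→ℚ*frac≡1 k)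

  r*e-suc : ∀ N → ℕ→ℚ r * e (suc N) ≡ e N
  r*e-suc N = begin
    ℕ→ℚ r * e (suc N)      ≡⟨ cong (ℕ→ℚ r *_) (e-suc N) ⟩
    ℕ→ℚ r * (u * e N)      ≡⟨ *-assoc (ℕ→ℚ r) u (e N) ⟨
    ℕ→ℚ r * u * e N        ≡⟨ cong (_* e N) r*u≡1 ⟩
    1ℚ * e N               ≡⟨ *-identityˡ (e N) ⟩
    e N                    ∎
    where open ≡-Reasoning

  e-nonNeg : ∀ N → 0ℚ ≤ e N
  e-nonNeg N = frac-nonNeg (r ℕ.^ N)

  e-pos : ∀ N → 0ℚ < e N
  e-pos N with r ℕ.^ N | r^N-suc N
  ... | .(suc k) | k , refl = frac-pos k

  u-nonNeg : 0ℚ ≤ u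
  u-nonNeg = frac-nonNeg r

  1+digit≤r : ∀ (a : Fin r) → 1ℚ + ℕ→ℚ (toℕ a) ≤ ℕ→ℚ r
  1+digit≤r a = subst (_≤ ℕ→ℚ r) (ℕ→ℚ-homo-+ 1 (toℕ a)) (ℕ→ℚ-mono-≤ (Fin.toℕ<n a))

  digit-bound : ∀ (a : Fin r) N → ℕ→ℚ (toℕ a) * e (suc N) ≤ e N - e (suc N)
  digit-bound a N = 0≤q-p⇒p≤q (subst (0ℚ ≤_) rearrange (p≤q⇒0≤q-p [1+a]e≤e))
    where
    A : ℚ
    A = ℕ→ℚ (toℕ a)
    [1+a]e≤e : (1ℚ + A) * e (suc N) ≤ e N
    [1+a]e≤e = subst ((1ℚ + A) * e (suc N) ≤_) (r*e-suc N) (*-monoʳ-nonNeg (e-nonNeg (suc N)) (1+digit≤r a))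
    rearrange : e N - (1ℚ + A) * e (suc N) ≡ (e N - e (suc N)) - A * e (suc N)
    rearrange = solve 3 (λ x a y → x :- (con 1ℚ :+ a) :* y := (x :- y) :- a :* y) refl (e N) A (e (suc N))

  -- The first coordinate of Λ_{r,m,a}: for x ∈ [-1, 1] and a digit a,
  -- (x - a) / r lies again in [-1, 1] (written with the empty partial sum 0).
  digit-step-bound : ∀ (a : Fin r) x → ∣ x + 0ℚ ∣ ≤ 1ℚ → ∣ (x - ℕ→ℚ (toℕ a)) * u + 0ℚ ∣ ≤ 1ℚ
  digit-step-bound a x ∣x∣≤1 = subst (_≤ 1ℚ) (cong ∣_∣ commute) (subst (∣ u * (x - A) ∣ ≤_) u*r≡1 scaled)
    where
    A : ℚ
    A = ℕ→ℚ (toℕ a)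
    x-bounds : - 1ℚ ≤ x × x ≤ 1ℚ
    x-bounds = ∣∣≤-elim (subst (λ q → ∣ q ∣ ≤ 1ℚ) (+-identityʳ x) ∣x∣≤1)
    r-1-a : 0ℚ ≤ ℕ→ℚ r - (1ℚ + A)
    r-1-a = p≤q⇒0≤q-p (1+digit≤r a)
    x+1 : 0ℚ ≤ x + 1ℚ
    x+1 = subst (0ℚ ≤_) (solve 1 (λ x → x :- (:- con 1ℚ) := x :+ con 1ℚ) refl x) (p≤q⇒0≤q-p (proj₁ x-bounds))
    1-x : 0ℚ ≤ 1ℚ - x
    1-x = p≤q⇒0≤q-p (proj₂ x-bounds)
    lower : - ℕ→ℚ r ≤ x - A
    lower = 0≤q-p⇒p≤q (subst (0ℚ ≤_)
      (solve 3 (λ x A r → (x :+ con 1ℚ) :+ (r :- (con 1ℚ :+ A)) := (x :- A) :- (:- r)) refl x A (ℕ→ℚ r))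
      (+-mono-≤ x+1 r-1-a))
    upper : x - A ≤ ℕ→ℚ r
    upper = 0≤q-p⇒p≤q (subst (0ℚ ≤_)
      (solve 3 (λ x A r → ((con 1ℚ :- x) :+ (r :- (con 1ℚ :+ A))) :+ (A :+ A) := r :- (x :- A)) refl x A (ℕ→ℚ r))
      (+-mono-≤ (+-mono-≤ 1-x r-1-a) (+-mono-≤ (ℕ→ℚ-nonNeg (toℕ a)) (ℕ→ℚ-nonNeg (toℕ a)))))
    scaled : ∣ u * (x - A) ∣ ≤ u * ℕ→ℚ r
    scaled = ∣∣≤-scale u-nonNeg (∣∣≤-intro lower upper)
    u*r≡1 : u * ℕ→ℚ r ≡ 1ℚ
    u*r≡1 = trans (*-comm u (ℕ→ℚ r)) r*u≡1
    commute : u * (x - A) ≡ (x - A) * u + 0ℚ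
    commute = solve 3 (λ x A u → u :* (x :- A) := (x :- A) :* u :+ con 0ℚ) refl x A u

  gap-pos : ∀ N → 0ℚ < e N - e (suc N)
  gap-pos N = <-≤-trans (e-pos (suc N)) (subst (_≤ e N - e (suc N)) (*-identityˡ (e (suc N))) (digit-bound (fs fz) N))

  e-antitone : ∀ N → e (suc N) ≤ e N
  e-antitone N = 0≤q-p⇒p≤q (<⇒≤ (gap-pos N))

  e≤1 : ∀ N → e N ≤ 1ℚ
  e≤1 zero    = ≤-refl
  e≤1 (suc N) = ≤-trans (e-antitone N) (e≤1 N)

  1-e-pos : ∀ l' → 0ℚ < 1ℚ - e (suc l')
  1-e-pos l' = <-≤-trans (gap-pos l') (+-monoˡ-≤ (- e (suc l')) (e≤1 l'))

  -- the geometric factor 1 / (1 - r^-l) of an l-periodic expansion, l = 1 + l'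
  1-e-nonZero : ∀ l' → NonZero (1ℚ - e (suc l'))
  1-e-nonZero l' = pos⇒nonZero (1ℚ - e (suc l')) {{positive (1-e-pos l')}}

  geo : ℕ → ℚ
  geo l' = (1/ (1ℚ - e (suc l'))) {{1-e-nonZero l'}}

  geo-nonNeg : ∀ l' → 0ℚ ≤ geo l'
  geo-nonNeg l' = <⇒≤ (positive⁻¹ (geo l') {{1/pos⇒pos (1ℚ - e (suc l')) {{positive (1-e-pos l')}}}})

  -- The ring solver does not know that (1 - r^-l) · geo = 1; identities involving
  -- geo are proved as polynomial identities up to a multiple of 1 - (1 - r^-l) · geo,
  -- which this lemma removes.
  cancel-geo : ∀ l' X Y → X + Y * (1ℚ - (1ℚ - e (suc l')) * geo l') ≡ X
  cancel-geo l' X Y = begin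
    X + Y * (1ℚ - (1ℚ - e (suc l')) * geo l')
      ≡⟨ cong (λ q → X + Y * (1ℚ - q)) (*-inverseʳ (1ℚ - e (suc l')) {{1-e-nonZero l'}}) ⟩
    X + Y * (1ℚ - 1ℚ)                         ≡⟨ cong (λ q → X + Y * q) (+-inverseʳ 1ℚ) ⟩
    X + Y * 0ℚ                                ≡⟨ cong (λ q → X + q) (*-zeroʳ Y) ⟩
    X + 0ℚ                                    ≡⟨ +-identityʳ X ⟩
    X                                         ∎
    where open ≡-Reasoning

module Expansion (r' m' : ℕ) where

  open import Defs
  open import Data.Nat as ℕ using (ℕ; zero; suc)
  import Data.Nat.Properties as ℕ
  import Data.Nat.DivMod as ℕ
  import Data.Nat.Solver as ℕ-Solver
  open import Data.Fin using (Fin; toℕ; fromℕ; inject₁) renaming (zero to fz; suc to fs)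
  import Data.Fin.Properties as Fin
  open import Data.Rational
  open import Data.Rational.Properties
  open import Data.Rational.Solver using (module +-*-Solver)
  open import Data.Product using (_×_; _,_; proj₁; proj₂; ∃-syntax)
  open import Relation.Binary.PropositionalEquality
  open RationalFacts
  open Powers r'
  open +-*-Solver
  open ℕ-Solver.+-*-Solver using () renaming (solve to solveℕ; _:=_ to _:=ℕ_; _:+_ to _:+ℕ_; _:*_ to _:*ℕ_; con to conℕ)

  m : ℕ
  m = suc m'

  Word : Set
  Word = ℕ → Fin r

  S : Word → Fin m → ℕ → ℚ
  S w i N = partialSum r m w i N

  -- the N-th digit of coordinate i, so that S w i (suc N) = S w i N + digit w i N * e (suc N)
  digit : Word → Fin m → ℕ → ℚ
  digit w i N = ℕ→ℚ (toℕ (w (m ℕ.* N ℕ.+ suc (toℕ i))))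

  partialSum-increment : ∀ w i N K →
    0ℚ ≤ S w i (K ℕ.+ N) - S w i N × S w i (K ℕ.+ N) - S w i N ≤ e N - e (K ℕ.+ N)
  partialSum-increment w i N zero =
    ≤-reflexive (sym (+-inverseʳ (S w i N))) ,
    ≤-reflexive (trans (+-inverseʳ (S w i N)) (sym (+-inverseʳ (e N))))
  partialSum-increment w i N (suc K) =
    subst (0ℚ ≤_) (sym regroup) (+-mono-≤ (proj₁ IH) (nonNeg-* (ℕ→ℚ-nonNeg (toℕ a)) (e-nonNeg (suc M)))) ,
    subst₂ _≤_ (sym regroup) telescope (+-mono-≤ (proj₂ IH) (digit-bound a M))
    where
    M : ℕ
    M = K ℕ.+ N
    IH : 0ℚ ≤ S w i M - S w i N × S w i M - S w i N ≤ e N - e M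
    IH = partialSum-increment w i N K
    a : Fin r
    a = w (m ℕ.* M ℕ.+ suc (toℕ i))
    t : ℚ
    t = digit w i M * e (suc M)
    regroup : S w i M + t - S w i N ≡ (S w i M - S w i N) + t
    regroup = solve 3 (λ a b t → a :+ t :- b := (a :- b) :+ t) refl (S w i M) (S w i N) t
    telescope : (e N - e M) + (e M - e (suc M)) ≡ e N - e (suc M)
    telescope = solve 3 (λ x y z → (x :- y) :+ (y :- z) := x :- z) refl (e N) (e M) (e (suc M))

  partialSum-shift : ∀ (w w' : Word) l → (∀ k → w' (suc k ℕ.+ m ℕ.* l) ≡ w (suc k)) →
    ∀ i N → S w' i (N ℕ.+ l) ≡ S w' i l + e l * S w i N
  partialSum-shift w w' l shift i zero =
    sym (trans (cong (λ q → S w' i l + q) (*-zeroʳ (e l))) (+-identityʳ _))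
  partialSum-shift w w' l shift i (suc N) = begin
    S w' i (N ℕ.+ l) + digit w' i (N ℕ.+ l) * e (suc N ℕ.+ l)
      ≡⟨ cong₂ (λ p q → p + q * e (suc N ℕ.+ l)) (partialSum-shift w w' l shift i N) same-digit ⟩
    (S w' i l + e l * S w i N) + digit w i N * e (suc N ℕ.+ l)
      ≡⟨ cong (λ q → (S w' i l + e l * S w i N) + digit w i N * q) (e-homo-+ (suc N) l) ⟩
    (S w' i l + e l * S w i N) + digit w i N * (e (suc N) * e l)
      ≡⟨ solve 5 (λ a c s d f → (a :+ c :* s) :+ d :* (f :* c) := a :+ c :* (s :+ d :* f)) refl
           (S w' i l) (e l) (S w i N) (digit w i N) (e (suc N)) ⟩
    S w' i l + e l * (S w i N + digit w i N * e (suc N))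
      ∎
    where
    open ≡-Reasoning
    t : ℕ
    t = toℕ i
    index : m ℕ.* (N ℕ.+ l) ℕ.+ suc t ≡ suc (m ℕ.* N ℕ.+ t) ℕ.+ m ℕ.* l
    index = solveℕ 4 (λ m N l t → m :*ℕ (N :+ℕ l) :+ℕ (conℕ 1 :+ℕ t) :=ℕ conℕ 1 :+ℕ (m :*ℕ N :+ℕ t) :+ℕ m :*ℕ l)
              refl m N l t
    same-digit : digit w' i (N ℕ.+ l) ≡ digit w i N
    same-digit = cong (λ a → ℕ→ℚ (toℕ a))
      (trans (cong w' index) (trans (shift (m ℕ.* N ℕ.+ t)) (cong w (sym (ℕ.+-suc (m ℕ.* N) t)))))

  partialSum-prefix : ∀ (w w' : Word) l → (∀ k → k ℕ.< m ℕ.* l → w (suc k) ≡ w' (suc k)) →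
    ∀ i N → N ℕ.≤ l → S w i N ≡ S w' i N
  partialSum-prefix w w' l agree i zero _ = refl
  partialSum-prefix w w' l agree i (suc N) N<l =
    cong₂ (λ p a → p + ℕ→ℚ (toℕ a) * e (suc N)) (partialSum-prefix w w' l agree i N (ℕ.<⇒≤ N<l))
      (trans (cong w index) (trans (agree _ in-prefix) (cong w' (sym index))))
    where
    index : m ℕ.* N ℕ.+ suc (toℕ i) ≡ suc (m ℕ.* N ℕ.+ toℕ i)
    index = ℕ.+-suc (m ℕ.* N) (toℕ i)
    in-prefix : m ℕ.* N ℕ.+ toℕ i ℕ.< m ℕ.* l
    in-prefix = ℕ.<-≤-trans (ℕ.+-monoʳ-< (m ℕ.* N) (Fin.toℕ<n i))
      (subst (ℕ._≤ m ℕ.* l) (trans (ℕ.*-suc m N) (ℕ.+-comm m (m ℕ.* N))) (ℕ.*-monoʳ-≤ m N<l))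

  λ-shift : ∀ (w w' : Word) l → (∀ k → w' (suc k ℕ.+ m ℕ.* l) ≡ w (suc k)) →
    ∀ v → IsLambda r m w' v → IsLambda r m w (λ i → (v i + S w' i l) * pow l)
  λ-shift w w' l shift v λw'≡v i N =
    *-cancelˡ-≤-pos (e l) {{positive (e-pos l)}} (subst₂ _≤_ scaled e-split (λw'≡v i (N ℕ.+ l)))
    where
    y : ℚ
    y = (v i + S w' i l) * pow l
    e-split : e (N ℕ.+ l) ≡ e l * e N
    e-split = trans (e-homo-+ N l) (*-comm (e N) (e l))
    unscale : e l * (y + S w i N) ≡ (v i + S w' i l) + e l * S w i N
    unscale = begin
      e l * (y + S w i N)
        ≡⟨ solve 5 (λ a b c s ρ → c :* ((a :+ b) :* ρ :+ s) := (a :+ b) :* (c :* ρ) :+ c :* s) refl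
             (v i) (S w' i l) (e l) (S w i N) (pow l) ⟩
      (v i + S w' i l) * (e l * pow l) + e l * S w i N
        ≡⟨ cong (λ q → (v i + S w' i l) * q + e l * S w i N) (e*pow≡1 l) ⟩
      (v i + S w' i l) * 1ℚ + e l * S w i N
        ≡⟨ cong (_+ e l * S w i N) (*-identityʳ (v i + S w' i l)) ⟩
      (v i + S w' i l) + e l * S w i N
        ∎
      where open ≡-Reasoning
    scaled : ∣ v i + S w' i (N ℕ.+ l) ∣ ≡ e l * ∣ y + S w i N ∣
    scaled = begin
      ∣ v i + S w' i (N ℕ.+ l) ∣          ≡⟨ cong (λ q → ∣ v i + q ∣) (partialSum-shift w w' l shift i N) ⟩
      ∣ v i + (S w' i l + e l * S w i N) ∣ ≡⟨ cong ∣_∣ (sym (+-assoc (v i) (S w' i l) (e l * S w i N))) ⟩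
      ∣ (v i + S w' i l) + e l * S w i N ∣ ≡⟨ cong ∣_∣ unscale ⟨
      ∣ e l * (y + S w i N) ∣              ≡⟨ ∣p*q∣≡∣p∣*∣q∣ (e l) _ ⟩
      ∣ e l ∣ * ∣ y + S w i N ∣            ≡⟨ cong (_* ∣ y + S w i N ∣) (0≤p⇒∣p∣≡p (e-nonNeg l)) ⟩
      e l * ∣ y + S w i N ∣                ∎
      where open ≡-Reasoning

  -- Partial sums of a word w' = a w with a letter prepended.  Coordinates 2..m
  -- of w' read coordinates 1..m-1 of w; coordinate 1 of w' reads a, then
  -- coordinate m of w one power of r later.
  module PrependedLetter (w w' : Word) (a : Fin r) (w'₁≡a : w' 1 ≡ a)
                         (w'-tail : ∀ k → w' (suc (suc k)) ≡ w (suc k)) where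
    A : ℚ
    A = ℕ→ℚ (toℕ a)
    last : Fin m
    last = fromℕ m'

    later-coordinates : ∀ j N → S w' (fs j) N ≡ S w (inject₁ j) N
    later-coordinates j zero = refl
    later-coordinates j (suc N) =
      cong₂ (λ p b → p + ℕ→ℚ (toℕ b) * e (suc N)) (later-coordinates j N)
        (trans (cong w' index) (trans (w'-tail (m ℕ.* N ℕ.+ toℕ j)) (cong w index′)))
      where
      index : m ℕ.* N ℕ.+ suc (suc (toℕ j)) ≡ suc (suc (m ℕ.* N ℕ.+ toℕ j))
      index = trans (ℕ.+-suc (m ℕ.* N) (suc (toℕ j))) (cong suc (ℕ.+-suc (m ℕ.* N) (toℕ j)))
      index′ : suc (m ℕ.* N ℕ.+ toℕ j) ≡ m ℕ.* N ℕ.+ suc (toℕ (inject₁ j))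
      index′ = trans (sym (ℕ.+-suc (m ℕ.* N) (toℕ j))) (cong (λ k → m ℕ.* N ℕ.+ suc k) (sym (Fin.toℕ-inject₁ j)))

    first-coordinate : ∀ N → S w' fz (suc N) ≡ A * u + u * S w last N
    first-coordinate zero = begin
      0ℚ + ℕ→ℚ (toℕ (w' (m ℕ.* 0 ℕ.+ 1))) * e 1
        ≡⟨ cong₂ (λ b q → 0ℚ + ℕ→ℚ (toℕ b) * q) (trans (cong w' (cong (ℕ._+ 1) (ℕ.*-zeroʳ m))) w'₁≡a) e-one ⟩
      0ℚ + A * u
        ≡⟨ solve 2 (λ A u → con 0ℚ :+ A :* u := A :* u :+ u :* con 0ℚ) refl A u ⟩
      A * u + u * 0ℚ
        ∎
      where open ≡-Reasoning
    first-coordinate (suc N) = begin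
      S w' fz (suc N) + digit w' fz (suc N) * e (suc (suc N))
        ≡⟨ cong₂ (λ p q → p + q * e (suc (suc N))) (first-coordinate N) same-digit ⟩
      (A * u + u * S w last N) + digit w last N * e (suc (suc N))
        ≡⟨ cong (λ q → (A * u + u * S w last N) + digit w last N * q) (e-suc (suc N)) ⟩
      (A * u + u * S w last N) + digit w last N * (u * e (suc N))
        ≡⟨ solve 5 (λ A u s d f → (A :* u :+ u :* s) :+ d :* (u :* f) := A :* u :+ u :* (s :+ d :* f)) refl
             A u (S w last N) (digit w last N) (e (suc N)) ⟩
      A * u + u * (S w last N + digit w last N * e (suc N))
        ∎
      where
      open ≡-Reasoning
      index : m ℕ.* suc N ℕ.+ 1 ≡ suc (suc (m ℕ.* N ℕ.+ m'))
      index = solveℕ 2 (λ m' N → (conℕ 1 :+ℕ m') :*ℕ (conℕ 1 :+ℕ N) :+ℕ conℕ 1 :=ℕ conℕ 2 :+ℕ ((conℕ 1 :+ℕ m') :*ℕ N :+ℕ m'))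
                refl m' N
      index′ : suc (m ℕ.* N ℕ.+ m') ≡ m ℕ.* N ℕ.+ suc (toℕ last)
      index′ = trans (sym (ℕ.+-suc (m ℕ.* N) m')) (cong (λ k → m ℕ.* N ℕ.+ suc k) (sym (Fin.toℕ-fromℕ m')))
      same-digit : digit w' fz (suc N) ≡ digit w last N
      same-digit = cong (λ b → ℕ→ℚ (toℕ b)) (trans (cong w' index) (trans (w'-tail _) (cong w index′)))

  λ-cons : ∀ (w w' : Word) (a : Fin r) → w' 1 ≡ a → (∀ k → w' (suc (suc k)) ≡ w (suc k)) →
    ∀ x → IsLambda r m w x → IsLambda r m w' (Λ r m a x)
  λ-cons w w' a w'₁≡a w'-tail x λw≡x (fs j) N =
    subst (λ q → ∣ x (inject₁ j) + q ∣ ≤ e N) (sym (later-coordinates j N)) (λw≡x (inject₁ j) N)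
    where open PrependedLetter w w' a w'₁≡a w'-tail
  λ-cons w w' a w'₁≡a w'-tail x λw≡x fz zero = digit-step-bound a (x last) (λw≡x last 0)
    where open PrependedLetter w w' a w'₁≡a w'-tail
  λ-cons w w' a w'₁≡a w'-tail x λw≡x fz (suc N) =
    subst₂ _≤_ (sym scaled) (sym (e-suc N)) (*-monoˡ-nonNeg u-nonNeg (λw≡x last N))
    where
    open PrependedLetter w w' a w'₁≡a w'-tail
    open ≡-Reasoning
    xₘ : ℚ
    xₘ = x last
    scaled : ∣ (xₘ - A) * u + S w' fz (suc N) ∣ ≡ u * ∣ xₘ + S w last N ∣
    scaled = begin
      ∣ (xₘ - A) * u + S w' fz (suc N) ∣       ≡⟨ cong (λ q → ∣ (xₘ - A) * u + q ∣) (first-coordinate N) ⟩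
      ∣ (xₘ - A) * u + (A * u + u * S w last N) ∣
        ≡⟨ cong ∣_∣ (solve 4 (λ x A u s → (x :- A) :* u :+ (A :* u :+ u :* s) := u :* (x :+ s)) refl xₘ A u (S w last N)) ⟩
      ∣ u * (xₘ + S w last N) ∣                 ≡⟨ ∣p*q∣≡∣p∣*∣q∣ u _ ⟩
      ∣ u ∣ * ∣ xₘ + S w last N ∣               ≡⟨ cong (_* ∣ xₘ + S w last N ∣) (0≤p⇒∣p∣≡p u-nonNeg) ⟩
      u * ∣ xₘ + S w last N ∣                   ∎

  -- λ of a periodic word: if w has period m·l, l = 1 + l', then coordinatewise
  -- λ(w) = - S w l / (1 - r^-l), the sum of the geometric series of its blocks.
  periodicValue : Word → ℕ → Fin m → ℚ
  periodicValue w l' i = - S w i (suc l') * geo l'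

  module PeriodicCoordinate (w : Word) (l' : ℕ) (period : ∀ k → w (suc k ℕ.+ m ℕ.* suc l') ≡ w (suc k))
                            (i : Fin m) where
    l : ℕ
    l = suc l'
    κ : ℚ
    κ = e l
    σ : ℚ
    σ = S w i l
    z : ℚ
    z = periodicValue w l' i

    σ-bounds : 0ℚ ≤ S w i (l ℕ.+ 0) - S w i 0 × S w i (l ℕ.+ 0) - S w i 0 ≤ e 0 - e (l ℕ.+ 0)
    σ-bounds = partialSum-increment w i 0 l
    σ≡ : S w i (l ℕ.+ 0) - S w i 0 ≡ σ
    σ≡ = trans (cong (λ n → S w i n - 0ℚ) (ℕ.+-identityʳ l)) (solve 1 (λ s → s :- con 0ℚ := s) refl σ)
    0≤σ : 0ℚ ≤ σ
    0≤σ = subst (0ℚ ≤_) σ≡ (proj₁ σ-bounds)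
    σ≤1-κ : σ ≤ 1ℚ - κ
    σ≤1-κ = subst₂ _≤_ σ≡ (cong (λ n → 1ℚ - e n) (ℕ.+-identityʳ l)) (proj₂ σ-bounds)
    z≤0 : 0ℚ ≤ 0ℚ - z
    z≤0 = subst (0ℚ ≤_) (solve 2 (λ s d → s :* d := con 0ℚ :- (:- s :* d)) refl σ (geo l')) (nonNeg-* 0≤σ (geo-nonNeg l'))
    z[1-κ]≡-σ : z * (1ℚ - κ) ≡ - σ
    z[1-κ]≡-σ = trans (solve 3 (λ s d κ → (:- s :* d) :* (con 1ℚ :- κ) := :- s :+ s :* (con 1ℚ :- (con 1ℚ :- κ) :* d))
                         refl σ (geo l') κ)
                      (cancel-geo l' (- σ) σ)
    -1≤z : 0ℚ ≤ z - (- 1ℚ)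
    -1≤z = p≤q⇒0≤q-p { - 1ℚ} {z} (*-cancelʳ-≤-pos (1ℚ - κ) {{positive (1-e-pos l')}}
      (subst₂ _≤_ (solve 1 (λ κ → :- (con 1ℚ :- κ) := (:- con 1ℚ) :* (con 1ℚ :- κ)) refl κ) (sym z[1-κ]≡-σ)
        (neg-antimono-≤ σ≤1-κ)))

    -- z + S (K + l) = r^-l (z + S K): one more period scales the error by κ = r^-l
    one-period : ∀ K → ∣ z + S w i K ∣ ≤ e K → ∣ z + S w i (K ℕ.+ l) ∣ ≤ e (K ℕ.+ l)
    one-period K bound = subst₂ _≤_ (cong ∣_∣ (sym scaled)) (trans (*-comm κ (e K)) (sym (e-homo-+ K l)))
                                  (∣∣≤-scale (e-nonNeg l) bound)
      where
      scaled : z + S w i (K ℕ.+ l) ≡ κ * (z + S w i K)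
      scaled = trans (cong (λ q → z + q) (partialSum-shift w w l period i K))
        (trans (solve 4 (λ s κ d t → (:- s :* d) :+ (s :+ κ :* t)
                                     := κ :* ((:- s :* d) :+ t) :+ s :* (con 1ℚ :- (con 1ℚ :- κ) :* d))
                  refl σ κ (geo l') (S w i K))
               (cancel-geo l' (κ * (z + S w i K)) σ))

    -- within the first period: z + S N = κ z - (σ - S N) with 0 ≤ σ - S N ≤ r^-N - κ
    first-period : ∀ N → N ℕ.< l → ∣ z + S w i N ∣ ≤ e N
    first-period N N<l = ∣∣≤-intro (0≤q-p⇒p≤q lower) (0≤q-p⇒p≤q upper)
      where
      l-N+N : l ℕ.∸ N ℕ.+ N ≡ l
      l-N+N = ℕ.m∸n+n≡m (ℕ.<⇒≤ N<l)
      rest : 0ℚ ≤ S w i (l ℕ.∸ N ℕ.+ N) - S w i N × S w i (l ℕ.∸ N ℕ.+ N) - S w i N ≤ e N - e (l ℕ.∸ N ℕ.+ N)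
      rest = partialSum-increment w i N (l ℕ.∸ N)
      0≤σ-S : 0ℚ ≤ σ - S w i N
      0≤σ-S = subst (λ n → 0ℚ ≤ S w i n - S w i N) l-N+N (proj₁ rest)
      σ-S≤ : 0ℚ ≤ (e N - κ) - (σ - S w i N)
      σ-S≤ = p≤q⇒0≤q-p (subst (λ n → S w i n - S w i N ≤ e N - e n) l-N+N (proj₂ rest))
      decompose : z + S w i N ≡ κ * z - (σ - S w i N)
      decompose = trans (solve 4 (λ s d κ t → (:- s :* d) :+ t
                                           := κ :* (:- s :* d) :- (s :- t) :+ s :* (con 1ℚ :- (con 1ℚ :- κ) :* d))
                           refl σ (geo l') κ (S w i N))
                        (cancel-geo l' (κ * z - (σ - S w i N)) σ)
      upper : 0ℚ ≤ e N - (z + S w i N)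
      upper = subst (0ℚ ≤_)
        (trans (solve 5 (λ eN κ z s t → eN :+ κ :* (con 0ℚ :- z) :+ (s :- t) := eN :- (κ :* z :- (s :- t)))
                  refl (e N) κ z σ (S w i N))
               (cong (λ q → e N - q) (sym decompose)))
        (+-mono-≤ (+-mono-≤ (e-nonNeg N) (nonNeg-* (e-nonNeg l) z≤0)) 0≤σ-S)
      lower : 0ℚ ≤ (z + S w i N) - (- e N)
      lower = subst (0ℚ ≤_)
        (trans (solve 5 (λ eN κ z s t → κ :* (z :- (:- con 1ℚ)) :+ ((eN :- κ) :- (s :- t))
                                        := (κ :* z :- (s :- t)) :- (:- eN))
                  refl (e N) κ z σ (S w i N))
               (cong (_- (- e N)) (sym decompose)))
        (+-mono-≤ (nonNeg-* (e-nonNeg l) -1≤z) σ-S≤)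

    after-periods : ∀ q ρ → ρ ℕ.< l → ∣ z + S w i (ρ ℕ.+ q ℕ.* l) ∣ ≤ e (ρ ℕ.+ q ℕ.* l)
    after-periods zero ρ ρ<l = subst (λ n → ∣ z + S w i n ∣ ≤ e n) (sym (ℕ.+-identityʳ ρ)) (first-period ρ ρ<l)
    after-periods (suc q) ρ ρ<l =
      subst (λ n → ∣ z + S w i n ∣ ≤ e n) regroup (one-period (ρ ℕ.+ q ℕ.* l) (after-periods q ρ ρ<l))
      where
      regroup : ρ ℕ.+ q ℕ.* l ℕ.+ l ≡ ρ ℕ.+ suc q ℕ.* l
      regroup = solveℕ 3 (λ ρ q l → ρ :+ℕ q :*ℕ l :+ℕ l :=ℕ ρ :+ℕ (l :+ℕ q :*ℕ l)) refl ρ q l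

  λ-periodic : ∀ (w : Word) l' → (∀ k → w (suc k ℕ.+ m ℕ.* suc l') ≡ w (suc k)) →
    IsLambda r m w (periodicValue w l')
  λ-periodic w l' period i N =
    subst (λ n → ∣ z + S w i n ∣ ≤ e n) (sym (ℕ.m≡m%n+[m/n]*n N l)) (after-periods (N ℕ./ l) (N ℕ.% l) (ℕ.m%n<n N l))
    where open PeriodicCoordinate w l' period i

  λ-convex-split : ∀ (w w₁ w₂ : Word) l' →
    (∀ k → w (suc k ℕ.+ m ℕ.* suc l') ≡ w₁ (suc k)) →
    (∀ k → w₂ (suc k ℕ.+ m ℕ.* suc l') ≡ w₂ (suc k)) →
    (∀ k → k ℕ.< m ℕ.* suc l' → w₂ (suc k) ≡ w (suc k)) →
    ∀ v → IsLambda r m w v →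
    ∃[ y ] ∃[ z ] (IsLambda r m w₁ y × IsLambda r m w₂ z × InConv2 v y z)
  λ-convex-split w w₁ w₂ l' suffix periodic prefix v λw≡v =
    y , z , λ-shift w₁ w l suffix v λw≡v , λ-periodic w₂ l' periodic ,
    e l , e-nonNeg l , e≤1 l , combination
    where
    l : ℕ
    l = suc l'
    y : Fin m → ℚ
    y = λ i → (v i + S w i l) * pow l
    z : Fin m → ℚ
    z = periodicValue w₂ l'
    combination : ∀ i → v i ≡ e l * y i + (1ℚ - e l) * z i
    combination i = sym (begin
      e l * ((v i + σ) * pow l) + (1ℚ - e l) * (- S w₂ i l * geo l')
        ≡⟨ cong (λ q → e l * ((v i + σ) * pow l) + (1ℚ - e l) * (- q * geo l'))
                (partialSum-prefix w₂ w l prefix i l ℕ.≤-refl) ⟩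
      e l * ((v i + σ) * pow l) + (1ℚ - e l) * (- σ * geo l')
        ≡⟨ solve 5 (λ v s c ρ d → c :* ((v :+ s) :* ρ) :+ (con 1ℚ :- c) :* (:- s :* d)
                                  := ((v :+ s) :* (c :* ρ) :- s) :+ s :* (con 1ℚ :- (con 1ℚ :- c) :* d))
             refl (v i) σ (e l) (pow l) (geo l') ⟩
      ((v i + σ) * (e l * pow l) - σ) + σ * (1ℚ - (1ℚ - e l) * geo l')
        ≡⟨ cancel-geo l' _ σ ⟩
      (v i + σ) * (e l * pow l) - σ
        ≡⟨ cong (λ q → (v i + σ) * q - σ) (e*pow≡1 l) ⟩
      (v i + σ) * 1ℚ - σ
        ≡⟨ solve 2 (λ v s → (v :+ s) :* con 1ℚ :- s := v) refl (v i) σ ⟩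
      v i
        ∎)
      where
      open ≡-Reasoning
      σ : ℚ
      σ = S w i l

module Walks {n r : ℕ} (T : Fin n → Fin r → Fin n → Set) where

  open import Defs
  open import Data.Nat as ℕ using (ℕ; zero; suc; _+_; _*_; _∸_; _<_; _≤_; s≤s; z<s)
  import Data.Nat.Properties as ℕ
  import Data.Nat.DivMod as ℕ
  open import Data.Nat.Induction using (<-rec)
  open import Data.Fin as Fin using (Fin; toℕ)
  import Data.Fin.Properties as Fin
  open import Data.List using (List; []; _∷_; _++_; map; length; lookup; applyUpTo)
  import Data.List.Properties as List
  import Data.List.Relation.Unary.All.Properties as All
  open import Data.List.Relation.Unary.AllPairs using (_∷_)
  open import Data.List.Relation.Unary.Unique.Propositional using (Unique)
  import Data.List.Relation.Unary.Unique.Propositional.Properties as Unique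
  open import Data.Product using (_×_; _,_; proj₁; proj₂; ∃)
  open import Data.Empty using (⊥-elim)
  open import Data.Unit using (tt)
  open import Data.Sum using (_⊎_; inj₁; inj₂)
  open import Relation.Binary.PropositionalEquality
  open import Relation.Nullary using (¬_; Dec; yes; no)
  open import Function using (_∘_; case_of_)

  Connected : InfPath T → Set
  Connected g = ∀ j → tgt (g j) ≡ src (g (suc j))

  applyUpTo-++ : ∀ {A : Set} (f : ℕ → A) a b →
    applyUpTo f (a + b) ≡ applyUpTo f a ++ applyUpTo (λ j → f (a + j)) b
  applyUpTo-++ f zero    b = refl
  applyUpTo-++ f (suc a) b = cong (f 0 ∷_) (applyUpTo-++ (λ j → f (suc j)) a b)

  consec-applyUpTo : ∀ g → Connected g → ∀ k → Consec T (applyUpTo g k)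
  consec-applyUpTo g connected zero          = tt
  consec-applyUpTo g connected (suc zero)    = tt
  consec-applyUpTo g connected (suc (suc k)) =
    connected 0 , consec-applyUpTo (λ j → g (suc j)) (λ j → connected (suc j)) (suc k)

  applyUpTo-consec : ∀ g k → Consec T (applyUpTo g k) → ∀ j → suc j < k → tgt (g j) ≡ src (g (suc j))
  applyUpTo-consec g (suc zero)    _              zero    (s≤s ())
  applyUpTo-consec g (suc (suc k)) (first , rest) zero    _               = first
  applyUpTo-consec g (suc (suc k)) (first , rest) (suc j) (s≤s j+1<k+1) =
    applyUpTo-consec (λ i → g (suc i)) (suc k) rest j j+1<k+1

  lastTgt-applyUpTo : ∀ (g : InfPath T) k → lastTgt T (g 0) (applyUpTo (λ j → g (suc j)) k) ≡ tgt (g k)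
  lastTgt-applyUpTo g zero    = refl
  lastTgt-applyUpTo g (suc k) = lastTgt-applyUpTo (λ j → g (suc j)) k

  unique-applyUpTo⁻ : ∀ {A : Set} (f : ℕ → A) k → Unique (applyUpTo f k) →
    ∀ {i j} → i < j → j < k → f i ≢ f j
  unique-applyUpTo⁻ f (suc k) (f0∉ ∷ _) {zero}  {suc j} _ (s≤s j<k) = All.applyUpTo⁻ (λ i → f (suc i)) k f0∉ j<k
  unique-applyUpTo⁻ f (suc k) (_ ∷ rest) {suc i} {suc j} (s≤s i<j) (s≤s j<k) =
    unique-applyUpTo⁻ (λ i → f (suc i)) k rest i<j j<k

  applyUpTo-lookup : ∀ {A : Set} (f : ℕ → A) (xs : List A) → (∀ i → f (toℕ i) ≡ lookup xs i) →
    applyUpTo f (length xs) ≡ xs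
  applyUpTo-lookup f []       _      = refl
  applyUpTo-lookup f (x ∷ xs) f≡xs[] =
    cong₂ _∷_ (f≡xs[] Fin.zero) (applyUpTo-lookup (λ j → f (suc j)) xs (λ i → f≡xs[] (Fin.suc i)))

  cyc-cong : ∀ c cs {j k} → j ℕ.% suc (length cs) ≡ k ℕ.% suc (length cs) → cyc T c cs j ≡ cyc T c cs k
  cyc-cong c cs {j} {k} j≡k = cong (lookup (c ∷ cs)) (Fin.toℕ-injective
    (trans (Fin.toℕ-fromℕ< _) (trans j≡k (sym (Fin.toℕ-fromℕ< _)))))

  cyc-periodic : ∀ c cs j q → cyc T c cs (j + q * suc (length cs)) ≡ cyc T c cs j
  cyc-periodic c cs j q = cyc-cong c cs {j + q * suc (length cs)} {j} (ℕ.[m+kn]%n≡m%n j q (suc (length cs)))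

  applyUpTo-cyc : ∀ c cs → applyUpTo (cyc T c cs) (suc (length cs)) ≡ c ∷ cs
  applyUpTo-cyc c cs = applyUpTo-lookup (cyc T c cs) (c ∷ cs) λ i →
    cong (lookup (c ∷ cs)) (Fin.toℕ-injective (trans (Fin.toℕ-fromℕ< _) (ℕ.m<n⇒m%n≡m (Fin.toℕ<n i))))

  evPer-loop : ∀ stem c cs j → evPer T stem c cs (length stem + j) ≡ cyc T c cs j
  evPer-loop []       c cs j = refl
  evPer-loop (x ∷ xs) c cs j = evPer-loop xs c cs j

  evPer-stem : ∀ g k c cs {j} → j < k → evPer T (applyUpTo g k) c cs j ≡ g j
  evPer-stem g (suc k) c cs {zero}  _         = refl
  evPer-stem g (suc k) c cs {suc j} (s≤s j<k) = evPer-stem (λ i → g (suc i)) k c cs j<k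

  applyUpTo-evPer : ∀ stem c cs k →
    applyUpTo (evPer T stem c cs) (length stem + k) ≡ stem ++ applyUpTo (cyc T c cs) k
  applyUpTo-evPer []       c cs k = refl
  applyUpTo-evPer (x ∷ xs) c cs k = cong (x ∷_) (applyUpTo-evPer xs c cs k)

  record SimpleShape (g : InfPath T) (s L : ℕ) : Set where
    field
      connected : Connected g
      periodic  : ∀ j → s ≤ j → g (j + suc L) ≡ g j
      distinct  : ∀ i j → i < j → j < s + suc L → src (g i) ≢ src (g j)

  -- A path that is periodic from s on is connected as soon as its first period
  -- after s is, by folding every index back into the window below s + (1 + L).
  periodic-connected : ∀ g s L → (∀ j → s ≤ j → g (j + suc L) ≡ g j) →
    (∀ j → j < s + suc L → tgt (g j) ≡ src (g (suc j))) → Connected g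
  periodic-connected g s L periodic window = <-rec _ step
    where
    step : ∀ j → (∀ {i} → i < j → tgt (g i) ≡ src (g (suc i))) → tgt (g j) ≡ src (g (suc j))
    step j below with j ℕ.<? s + suc L
    ... | yes j<K = window j j<K
    ... | no  j≮K = begin
      tgt (g j)                  ≡⟨ cong (tgt ∘ g) (sym j'+p≡j) ⟩
      tgt (g (j' + suc L))       ≡⟨ cong tgt (periodic j' s≤j') ⟩
      tgt (g j')                 ≡⟨ below j'<j ⟩
      src (g (suc j'))           ≡⟨ cong src (periodic (suc j') (ℕ.m≤n⇒m≤1+n s≤j')) ⟨
      src (g (suc j' + suc L))   ≡⟨ cong (src ∘ g) (cong suc j'+p≡j) ⟩
      src (g (suc j))            ∎
      where
      open ≡-Reasoning
      K≤j : s + suc L ≤ j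
      K≤j = ℕ.≮⇒≥ j≮K
      j' : ℕ
      j' = j ∸ suc L
      j'+p≡j : j' + suc L ≡ j
      j'+p≡j = ℕ.m∸n+n≡m (ℕ.≤-trans (ℕ.m≤n+m (suc L) s) K≤j)
      s≤j' : s ≤ j'
      s≤j' = subst (_≤ j') (ℕ.m+n∸n≡m s (suc L)) (ℕ.∸-monoˡ-≤ (suc L) K≤j)
      j'<j : j' < j
      j'<j = subst (j' <_) j'+p≡j (ℕ.m<m+n j' z<s)

  module _ {g : InfPath T} {s L : ℕ} (shape : SimpleShape g s L) where
    open SimpleShape shape

    periodic-iter : ∀ q x → s ≤ x → g (x + q * suc L) ≡ g x
    periodic-iter zero    x s≤x = cong g (ℕ.+-identityʳ x)
    periodic-iter (suc q) x s≤x = begin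
      g (x + (suc L + q * suc L))   ≡⟨ cong g (cong (x +_) (ℕ.+-comm (suc L) (q * suc L))) ⟩
      g (x + (q * suc L + suc L))   ≡⟨ cong g (sym (ℕ.+-assoc x (q * suc L) (suc L))) ⟩
      g (x + q * suc L + suc L)     ≡⟨ periodic (x + q * suc L) (ℕ.≤-trans s≤x (ℕ.m≤m+n x (q * suc L))) ⟩
      g (x + q * suc L)             ≡⟨ periodic-iter q x s≤x ⟩
      g x                           ∎
      where open ≡-Reasoning

    -- Any 1 + L consecutive transitions after the stem have distinct sources:
    -- reduce the later one by a period until both lie in the first loop.
    loop-distinct : ∀ b a → s ≤ a → a < b → b < a + suc L → src (g a) ≢ src (g b)
    loop-distinct = <-rec _ step
      where
      step : ∀ b → (∀ {b'} → b' < b → ∀ a → s ≤ a → a < b' → b' < a + suc L → src (g a) ≢ src (g b')) →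
             ∀ a → s ≤ a → a < b → b < a + suc L → src (g a) ≢ src (g b)
      step b below a s≤a a<b b<a+p with b ℕ.<? s + suc L
      ... | yes b<K = distinct a b a<b b<K
      ... | no  b≮K = λ same → below a<b b' s≤b' b'<a a<b'+p
                                   (sym (trans same (cong src (trans (cong g (sym b'+p≡b)) (periodic b' s≤b')))))
        where
        K≤b : s + suc L ≤ b
        K≤b = ℕ.≮⇒≥ b≮K
        b' : ℕ
        b' = b ∸ suc L
        b'+p≡b : b' + suc L ≡ b
        b'+p≡b = ℕ.m∸n+n≡m (ℕ.≤-trans (ℕ.m≤n+m (suc L) s) K≤b)
        s≤b' : s ≤ b'
        s≤b' = subst (_≤ b') (ℕ.m+n∸n≡m s (suc L)) (ℕ.∸-monoˡ-≤ (suc L) K≤b)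
        b'<a : b' < a
        b'<a = ℕ.+-cancelʳ-< (suc L) b' a (subst (_< a + suc L) (sym b'+p≡b) b<a+p)
        a<b'+p : a < b' + suc L
        a<b'+p = subst (a <_) (sym b'+p≡b) a<b

    shape⇒simple : IsSimpleFryPan T g
    shape⇒simple = F , simple , denotes
      where
      loop : InfPath T
      loop j = g (s + j)

      F : FryPan T
      F = record
        { stem   = applyUpTo g s
        ; c      = loop 0
        ; cs     = applyUpTo (λ j → loop (suc j)) L
        ; consec = subst (Consec T) (applyUpTo-++ g s (suc L)) (consec-applyUpTo g connected (s + suc L))
        ; closed = loop-closes
        }
        where
        loop-closes : lastTgt T (loop 0) (applyUpTo (λ j → loop (suc j)) L) ≡ src (loop 0)
        loop-closes = begin
          lastTgt T (loop 0) (applyUpTo (λ j → loop (suc j)) L)  ≡⟨ lastTgt-applyUpTo loop L ⟩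
          tgt (g (s + L))          ≡⟨ connected (s + L) ⟩
          src (g (suc (s + L)))    ≡⟨ cong (src ∘ g) (ℕ.+-suc s L) ⟨
          src (g (s + suc L))      ≡⟨ cong src (periodic s ℕ.≤-refl) ⟩
          src (g s)                ≡⟨ cong (src ∘ g) (ℕ.+-identityʳ s) ⟨
          src (loop 0)             ∎
          where open ≡-Reasoning

      simple : SimpleRep T F
      simple = subst (λ xs → Unique (map src xs)) (applyUpTo-++ g s (suc L))
        (subst Unique (sym (List.map-applyUpTo g src (s + suc L)))
          (Unique.applyUpTo⁺₁ (src ∘ g) (s + suc L) (λ i<j j<K → distinct _ _ i<j j<K)))

      loop-denotes : ∀ d → cyc T (FryPan.c F) (FryPan.cs F) d ≡ g (s + d)
      loop-denotes d = begin
        cyc T (loop 0) loopTail d                  ≡⟨ List.lookup-applyUpTo loop (suc L) (d ℕ.mod suc (length loopTail)) ⟩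
        g (s + toℕ (d ℕ.mod suc (length loopTail))) ≡⟨ cong (λ k → g (s + k)) (Fin.toℕ-fromℕ< _) ⟩
        g (s + d ℕ.% suc (length loopTail))
          ≡⟨ cong (λ k → g (s + d ℕ.% suc k)) (List.length-applyUpTo (λ j → loop (suc j)) L) ⟩
        g (s + d ℕ.% suc L)                  ≡⟨ periodic-iter (d ℕ./ suc L) (s + d ℕ.% suc L) (ℕ.m≤m+n s _) ⟨
        g (s + d ℕ.% suc L + d ℕ./ suc L * suc L)  ≡⟨ cong g (ℕ.+-assoc s _ _) ⟩
        g (s + (d ℕ.% suc L + d ℕ./ suc L * suc L)) ≡⟨ cong (λ k → g (s + k)) (ℕ.m≡m%n+[m/n]*n d (suc L)) ⟨
        g (s + d)                            ∎
        where
        open ≡-Reasoning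
        loopTail : List (Trans T)
        loopTail = applyUpTo (λ j → loop (suc j)) L

      denotes : ∀ j → path T F j ≡ g j
      denotes j with j ℕ.<? s
      ... | yes j<s = evPer-stem g s (loop 0) _ j<s
      ... | no  j≮s = begin
        path T F j                     ≡⟨ cong (path T F) j≡ ⟨
        path T F (length (applyUpTo g s) + (j ∸ s))  ≡⟨ evPer-loop (applyUpTo g s) (loop 0) _ (j ∸ s) ⟩
        cyc T (loop 0) _ (j ∸ s)        ≡⟨ loop-denotes (j ∸ s) ⟩
        g (s + (j ∸ s))                ≡⟨ cong g (ℕ.m+[n∸m]≡n (ℕ.≮⇒≥ j≮s)) ⟩
        g j                            ∎
        where
        open ≡-Reasoning
        j≡ : length (applyUpTo g s) + (j ∸ s) ≡ j
        j≡ = trans (cong (_+ (j ∸ s)) (List.length-applyUpTo g s)) (ℕ.m+[n∸m]≡n (ℕ.≮⇒≥ j≮s))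

  simple⇒shape : (F : FryPan T) → SimpleRep T F → SimpleShape (path T F) (length (stem F)) (length (cs F))
  simple⇒shape F simple = record
    { connected = periodic-connected g s L periodic window
    ; periodic  = periodic
    ; distinct  = λ i j i<j j<K → unique-applyUpTo⁻ (src ∘ g) (s + suc L) unique i<j j<K
    }
    where
    g : InfPath T
    g = path T F
    s : ℕ
    s = length (stem F)
    L : ℕ
    L = length (cs F)
    cy : InfPath T
    cy = cyc T (c F) (cs F)

    listed : applyUpTo g (s + suc L) ≡ stem F ++ c F ∷ cs F
    listed = trans (applyUpTo-evPer (stem F) (c F) (cs F) (suc L)) (cong (stem F ++_) (applyUpTo-cyc (c F) (cs F)))

    unique : Unique (applyUpTo (src ∘ g) (s + suc L))
    unique = subst Unique (List.map-applyUpTo g src (s + suc L))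
      (subst (λ xs → Unique (map src xs)) (sym listed) simple)

    periodic : ∀ j → s ≤ j → g (j + suc L) ≡ g j
    periodic j s≤j = begin
      g (j + suc L)              ≡⟨ cong (λ k → g (k + suc L)) j≡ ⟨
      g (s + d + suc L)          ≡⟨ cong g (ℕ.+-assoc s d (suc L)) ⟩
      g (s + (d + suc L))        ≡⟨ evPer-loop (stem F) (c F) (cs F) (d + suc L) ⟩
      cy (d + suc L)             ≡⟨ cong cy (cong (d +_) (ℕ.+-identityʳ (suc L))) ⟨
      cy (d + 1 * suc L)         ≡⟨ cyc-periodic (c F) (cs F) d 1 ⟩
      cy d                       ≡⟨ evPer-loop (stem F) (c F) (cs F) d ⟨
      g (s + d)                  ≡⟨ cong g j≡ ⟩
      g j                        ∎
      where
      open ≡-Reasoning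
      d : ℕ
      d = j ∸ s
      j≡ : s + d ≡ j
      j≡ = ℕ.m+[n∸m]≡n s≤j

    loop-closes : tgt (g (s + L)) ≡ src (g (suc (s + L)))
    loop-closes = begin
      tgt (g (s + L))                               ≡⟨ cong tgt (evPer-loop (stem F) (c F) (cs F) L) ⟩
      tgt (cy L)                                    ≡⟨ lastTgt-applyUpTo cy L ⟨
      lastTgt T (cy 0) (applyUpTo (λ j → cy (suc j)) L) ≡⟨ cong₂ (lastTgt T) (proj₁ cy≡) (proj₂ cy≡) ⟩
      lastTgt T (c F) (cs F)                        ≡⟨ closed F ⟩
      src (c F)                                     ≡⟨ cong src (proj₁ cy≡) ⟨
      src (cy 0)                                    ≡⟨ cong src (evPer-loop (stem F) (c F) (cs F) 0) ⟨
      src (g (s + 0))                               ≡⟨ cong src (periodic (s + 0) (ℕ.m≤m+n s 0)) ⟨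
      src (g (s + 0 + suc L))
        ≡⟨ cong (src ∘ g) (trans (cong (_+ suc L) (ℕ.+-identityʳ s)) (ℕ.+-suc s L)) ⟩
      src (g (suc (s + L)))                         ∎
      where
      open ≡-Reasoning
      cy≡ : cy 0 ≡ c F × applyUpTo (λ j → cy (suc j)) L ≡ cs F
      cy≡ = List.∷-injective (applyUpTo-cyc (c F) (cs F))

    window : ∀ j → j < s + suc L → tgt (g j) ≡ src (g (suc j))
    window j j<K with ℕ.m<1+n⇒m<n∨m≡n (subst (j <_) (ℕ.+-suc s L) j<K)
    ... | inj₁ j<s+L  = applyUpTo-consec g (s + suc L) (subst (Consec T) (sym listed) (consec F)) j
                          (subst (suc j <_) (sym (ℕ.+-suc s L)) (s≤s j<s+L))
    ... | inj₂ refl   = loop-closes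

  periodicPrefix-mod : ∀ k0 (p : InfPath T) j → periodicPrefix T k0 p j ≡ p (j ℕ.% suc k0)
  periodicPrefix-mod k0 p j = cong p (Fin.toℕ-fromℕ< _)

  periodicPrefix-periodic : ∀ k0 (p : InfPath T) j → periodicPrefix T k0 p (j + suc k0) ≡ periodicPrefix T k0 p j
  periodicPrefix-periodic k0 p j = begin
    periodicPrefix T k0 p (j + suc k0)  ≡⟨ periodicPrefix-mod k0 p (j + suc k0) ⟩
    p ((j + suc k0) ℕ.% suc k0)         ≡⟨ cong p (ℕ.[m+n]%n≡m%n j (suc k0)) ⟩
    p (j ℕ.% suc k0)                    ≡⟨ periodicPrefix-mod k0 p j ⟨
    periodicPrefix T k0 p j             ∎
    where open ≡-Reasoning

  periodicPrefix-prefix : ∀ k0 (p : InfPath T) j → j < suc k0 → periodicPrefix T k0 p j ≡ p j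
  periodicPrefix-prefix k0 p j j<n = trans (periodicPrefix-mod k0 p j) (cong p (ℕ.m<n⇒m%n≡m j<n))

  least-below : {P : ℕ → Set} → (∀ j → Dec (P j)) → ∀ k →
    (∃ λ j → j < k × P j × (∀ i → i < j → ¬ P i)) ⊎ (∀ j → j < k → ¬ P j)
  least-below P? zero = inj₂ (λ _ ())
  least-below P? (suc k) with least-below P? k
  ... | inj₁ (j , j<k , Pj , least) = inj₁ (j , ℕ.m<n⇒m<1+n j<k , Pj , least)
  ... | inj₂ none with P? k
  ...   | yes Pk = inj₁ (k , ℕ.≤-refl , Pk , none)
  ...   | no ¬Pk = inj₂ λ j j<1+k → case ℕ.m<1+n⇒m<n∨m≡n j<1+k of λ where
            (inj₁ j<k)  → none j j<k
            (inj₂ refl) → ¬Pk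

  record FirstReturn (t : Trans T) (θ' : FryPan T) : Set where
    field
      k0         : ℕ
      returns    : tgt (consPath T t (path T θ') k0) ≡ src t
      first      : ∀ j → j < k0 → tgt (consPath T t (path T θ') j) ≢ src t
      π-cycle    : IsCycle T t (applyUpTo (path T θ') k0)
      θ-simple   : IsSimpleFryPan T (dropPath T (suc k0) (consPath T t (path T θ')))
      π^ω-simple : IsSimpleFryPan T (periodicPrefix T k0 (consPath T t (path T θ')))

  module FirstReturnOf (t : Trans T) (θ' : FryPan T) (simple : SimpleRep T θ') (starts : start T θ' ≡ tgt t) where
    g : InfPath T
    g = path T θ'
    s : ℕ
    s = length (stem θ')
    L : ℕ
    L = length (cs θ')
    K : ℕ
    K = s + suc L
    open SimpleShape (simple⇒shape θ' simple)
    P : InfPath T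
    P = consPath T t g

    P-connected : Connected P
    P-connected zero    = sym starts
    P-connected (suc j) = connected j

    -- If no state of θ' up to the closing of its loop is q = src t, then t θ'
    -- is itself a simple fry-pan (with a stem one longer).
    never-returns⇒simple : (∀ j → j < K → src (g j) ≢ src t) → IsSimpleFryPan T P
    never-returns⇒simple none = shape⇒simple {P} {suc s} {L} record
      { connected = P-connected ; periodic = P-periodic ; distinct = P-distinct }
      where
      P-periodic : ∀ j → suc s ≤ j → P (j + suc L) ≡ P j
      P-periodic (suc j) (s≤s s≤j) = periodic j s≤j
      P-distinct : ∀ i j → i < j → j < suc s + suc L → src (P i) ≢ src (P j)
      P-distinct zero    (suc j) _         (s≤s j<K) = none j j<K ∘ sym
      P-distinct (suc i) (suc j) (s≤s i<j) (s≤s j<K) = distinct i j i<j j<K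

    module Returning (k0 : ℕ) (k0<K : k0 < K) (hit : src (g k0) ≡ src t)
                     (before : ∀ i → i < k0 → src (g i) ≢ src t) where
      returns : tgt (P k0) ≡ src t
      returns = trans (P-connected k0) hit

      first : ∀ j → j < k0 → tgt (P j) ≢ src t
      first j j<k0 returns-early = before j j<k0 (trans (sym (P-connected j)) returns-early)

      π-cycle : IsCycle T t (applyUpTo g k0)
      π-cycle = consec-applyUpTo P P-connected (suc k0) , sym (trans (lastTgt-applyUpTo P k0) returns)

      -- θ = θ' shifted by k0; its stem is what remains of the stem of θ'
      θ-simple : IsSimpleFryPan T (dropPath T (suc k0) P)
      θ-simple = shape⇒simple {dropPath T (suc k0) P} {s ∸ k0} {L} record
        { connected = λ j → trans (connected (k0 + j)) (cong (src ∘ g) (sym (ℕ.+-suc k0 j)))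
        ; periodic  = θ-periodic
        ; distinct  = θ-distinct
        }
        where
        θ-periodic : ∀ j → s ∸ k0 ≤ j → g (k0 + (j + suc L)) ≡ g (k0 + j)
        θ-periodic j s-k0≤j = trans (cong g (sym (ℕ.+-assoc k0 j (suc L))))
          (periodic (k0 + j) (ℕ.≤-trans (ℕ.m≤n+m∸n s k0) (ℕ.+-monoʳ-≤ k0 s-k0≤j)))
        θ-distinct : ∀ i j → i < j → j < s ∸ k0 + suc L → src (g (k0 + i)) ≢ src (g (k0 + j))
        θ-distinct i j i<j j<K' with k0 ℕ.≤? s
        ... | yes k0≤s = distinct (k0 + i) (k0 + j) (ℕ.+-monoʳ-< k0 i<j)
          (subst (k0 + j <_) (trans (sym (ℕ.+-assoc k0 (s ∸ k0) (suc L))) (cong (_+ suc L) (ℕ.m+[n∸m]≡n k0≤s)))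
            (ℕ.+-monoʳ-< k0 j<K'))
        ... | no  k0≰s = loop-distinct (simple⇒shape θ' simple) (k0 + j) (k0 + i)
          (ℕ.≤-trans (ℕ.<⇒≤ (ℕ.≰⇒> k0≰s)) (ℕ.m≤m+n k0 i)) (ℕ.+-monoʳ-< k0 i<j)
          (ℕ.<-≤-trans (ℕ.+-monoʳ-< k0 j<p) (ℕ.+-monoˡ-≤ (suc L) (ℕ.m≤m+n k0 i)))
          where
          -- here the stem of θ is empty, so j ranges over one loop
          j<p : j < suc L
          j<p = subst (λ x → j < x + suc L) (ℕ.m≤n⇒m∸n≡0 (ℕ.<⇒≤ (ℕ.≰⇒> k0≰s))) j<K'

      -- π^ω repeats t θ'(0) ⋯ θ'(k0-1), whose sources are distinct by minimality of k0
      π^ω-simple : IsSimpleFryPan T (periodicPrefix T k0 P)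
      π^ω-simple = shape⇒simple {R} {0} {k0} record
        { connected = periodic-connected R 0 k0 (λ j _ → periodicPrefix-periodic k0 P j) R-window
        ; periodic  = λ j _ → periodicPrefix-periodic k0 P j
        ; distinct  = R-distinct
        }
        where
        R : InfPath T
        R = periodicPrefix T k0 P
        R≡P : ∀ j → j < suc k0 → R j ≡ P j
        R≡P = periodicPrefix-prefix k0 P
        R-window : ∀ j → j < suc k0 → tgt (R j) ≡ src (R (suc j))
        R-window j j<n with ℕ.m<1+n⇒m<n∨m≡n j<n
        ... | inj₁ j<k0 = trans (cong tgt (R≡P j j<n)) (trans (P-connected j) (cong src (sym (R≡P (suc j) (s≤s j<k0)))))
        ... | inj₂ refl = trans (cong tgt (R≡P j j<n))
                            (trans returns (cong src (sym (trans (periodicPrefix-periodic k0 P 0) (R≡P 0 z<s)))))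
        P-distinct : ∀ i j → i < j → j < suc k0 → src (P i) ≢ src (P j)
        P-distinct zero    (suc j) _         (s≤s j<k0) = before j j<k0 ∘ sym
        P-distinct (suc i) (suc j) (s≤s i<j) (s≤s j<k0) = distinct i j i<j (ℕ.<-trans j<k0 k0<K)
        R-distinct : ∀ i j → i < j → j < 0 + suc k0 → src (R i) ≢ src (R j)
        R-distinct i j i<j j<n same = P-distinct i j i<j j<n
          (trans (cong src (sym (R≡P i (ℕ.<-trans i<j j<n)))) (trans same (cong src (R≡P j j<n))))

      found : FirstReturn t θ'
      found = record { k0 = k0 ; returns = returns ; first = first ; π-cycle = π-cycle
                     ; θ-simple = θ-simple ; π^ω-simple = π^ω-simple }

    first-return : ¬ IsSimpleFryPan T P → FirstReturn t θ'
    first-return not-simple with least-below (λ j → src (g j) Fin.≟ src t) K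
    ... | inj₁ (k0 , k0<K , hit , before) = Returning.found k0 k0<K hit before
    ... | inj₂ none                       = ⊥-elim (not-simple (never-returns⇒simple none))

  first-return : ∀ t θ' → SimpleRep T θ' → start T θ' ≡ tgt t →
    ¬ IsSimpleFryPan T (consPath T t (path T θ')) → FirstReturn t θ'
  first-return t θ' simple starts = FirstReturnOf.first-return t θ' simple starts

module PathExpansion (r' m' : ℕ) {n : ℕ} (T : Fin n → Fin (suc (suc r')) → Fin n → Set) where

  open import Defs
  open import Data.Nat as ℕ using (ℕ; suc; _<_)
  import Data.Nat.Properties as ℕ
  open import Data.Nat.Divisibility using (_∣_; divides)
  open import Data.List using ([]; _∷_; length)
  open import Data.Product using (_×_; _,_; ∃; ∃-syntax)
  open import Function using (_∘_)
  open import Relation.Binary.PropositionalEquality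
  open Powers r' using (r)
  open Expansion r' m'
  open Walks T

  -- Every fry-pan has a λ: its loop is a periodic word, and each letter of the
  -- stem is a Λ-step.
  λ-exists : ∀ stem c cs → ∃ λ x → IsLambda r m (word T (evPer T stem c cs)) x
  λ-exists [] c cs =
    periodicValue (word T (cyc T c cs)) (length cs) ,
    λ-periodic (word T (cyc T c cs)) (length cs) (λ k → cong lab (cyc-periodic c cs k m))
  λ-exists (x ∷ xs) c cs with λ-exists xs c cs
  ... | y , λ≡y = Λ r m (lab x) y , λ-cons _ _ (lab x) refl (λ _ → refl) y λ≡y

  λ-first-return : ∀ (p : InfPath T) k0 → m ∣ suc k0 → ∀ v → IsLambda r m (word T p) v →
    ∃[ y ] ∃[ z ] (IsLambda r m (word T (dropPath T (suc k0) p)) y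
                 × IsLambda r m (word T (periodicPrefix T k0 p)) z × InConv2 v y z)
  -- (k0 + 1 = 0 · m is impossible, so the quotient is some l = 1 + l')
  λ-first-return p k0 (divides (suc l') k0+1≡) =
    λ-convex-split (word T p) (word T (dropPath T (suc k0) p)) (word T R) l' suffix periodic prefix
    where
    R : InfPath T
    R = periodicPrefix T k0 p
    ml≡k0+1 : m ℕ.* suc l' ≡ suc k0
    ml≡k0+1 = trans (ℕ.*-comm m (suc l')) (sym k0+1≡)
    suffix : ∀ k → lab (p (k ℕ.+ m ℕ.* suc l')) ≡ lab (p (suc k0 ℕ.+ k))
    suffix k = cong (lab ∘ p) (trans (cong (k ℕ.+_) ml≡k0+1) (ℕ.+-comm k (suc k0)))
    periodic : ∀ k → lab (R (k ℕ.+ m ℕ.* suc l')) ≡ lab (R k)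
    periodic k = cong lab (trans (cong (λ j → R (k ℕ.+ j)) ml≡k0+1) (periodicPrefix-periodic k0 p k))
    prefix : ∀ k → k < m ℕ.* suc l' → lab (R k) ≡ lab (p k)
    prefix k k<ml = cong lab (periodicPrefix-prefix k0 p k (subst (k <_) ml≡k0+1 k<ml))

  λ-part : ∀ t θ' k0 → m ∣ suc k0 →
    ∃[ x ] ∃[ y ] ∃[ z ] (IsLambda r m (word T (path T θ')) x
      × IsLambda r m (word T (dropPath T (suc k0) (consPath T t (path T θ')))) y
      × IsLambda r m (word T (periodicPrefix T k0 (consPath T t (path T θ')))) z
      × InConv2 (Λ r m (lab t) x) y z)
  λ-part t θ' k0 m∣k0+1 with λ-exists (stem θ') (c θ') (cs θ')
  ... | x , λθ'≡x with λ-first-return (consPath T t (path T θ')) k0 m∣k0+1 (Λ r m (lab t) x)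
                         (λ-cons _ _ (lab t) refl (λ _ → refl) x λθ'≡x)
  ...   | y , z , λθ≡y , λπ^ω≡z , convex = x , y , z , λθ'≡x , λθ≡y , λπ^ω≡z , convex

open import Defs
open import Data.Nat using (ℕ; suc; _≤_; _<_; _+_)
open import Data.Fin using (Fin)
open import Data.Product using (Σ; _×_; ∃-syntax)
open import Relation.Nullary using (¬_)
open import Relation.Binary.PropositionalEquality using (_≡_; _≢_)

open import Data.Nat using (s≤s; z≤n)
open import Data.Nat.Divisibility using (_∣_)
open import Data.List.Properties using (length-applyUpTo)
open import Data.Product using (_,_)
open import Relation.Binary.PropositionalEquality using (cong; subst)

proposition4 : (r m : ℕ) → 2 ≤ r → 1 ≤ m → (n : ℕ) → 1 ≤ n →
    (T : Fin n → Fin r → Fin n → Set) → IsMGraph T m →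
    (t : Trans T) → (θ' : FryPan T) → SimpleRep T θ' → start T θ' ≡ Trans.tgt t →
    ¬ IsSimpleFryPan T (consPath T t (path T θ')) →
    ∃[ k0 ] (Trans.tgt (consPath T t (path T θ') k0) ≡ Trans.src t
      × (∀ j → j < k0 → Trans.tgt (consPath T t (path T θ') j) ≢ Trans.src t)
      × IsSimpleFryPan T (dropPath T (suc k0) (consPath T t (path T θ')))
      × IsSimpleFryPan T (periodicPrefix T k0 (consPath T t (path T θ')))
      × ∃[ x ] ∃[ y ] ∃[ z ] (IsLambda r m (word T (path T θ')) x
        × IsLambda r m (word T (dropPath T (suc k0) (consPath T t (path T θ')))) y
        × IsLambda r m (word T (periodicPrefix T k0 (consPath T t (path T θ')))) z
        × InConv2 (Λ r m (Trans.lab t) x) y z))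
proposition4 (suc (suc r')) (suc m') (s≤s (s≤s z≤n)) (s≤s z≤n) _ _ T m-graph t θ' simple starts not-simple =
  k0 , returns , first , θ-simple , π^ω-simple , λ-part t θ' k0 m∣k0+1
  where
  open Walks.FirstReturn (Walks.first-return T t θ' simple starts not-simple)
  open PathExpansion r' m' T using (λ-part)
  -- the first return π is a cycle of G, so its length k0 + 1 is a multiple of m
  m∣k0+1 : suc m' ∣ suc k0
  m∣k0+1 = subst (suc m' ∣_) (cong suc (length-applyUpTo (path T θ') k0)) (m-graph t _ π-cycle)
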